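{- Let $k\ge r\ge 1$ be integers, let $\ell=\lceil k/2\rceil$, and let $\mathcal{F}$ be a family of $n$ distinct $\ell$-subsets of $[k]$. Suppose that there exists an $[r]$-preserving and $[r]$-intersection shifting bijection $h:\mathcal{F}\to\mathcal{F}$. Then the matrix $C_n$ is $(r,k-r,k-r)$-coverable. In particular, $\mathrm{R}_{\mathbb{B}}(C_n\otimes C_n)\le k^2-r^2$.
   Context: $[k]=\{1,\ldots,k\}$ and for $F\subseteq[k]$, $\overline{F}=[k]\setminus F$. For a family $\mathcal{F}$ of subsets of $[k]$, $L\subseteq[k]$ and a function $h:\mathcal{F}\to\mathcal{F}$: $h$ is $L$-preserving if $D\cap L=h(D)\cap L$ for every $D\in\mathcal{F}$; $h$ is $L$-intersection shifting if for every $D,E\in\mathcal{F}$ with $\emptyset\ne D\cap\overline{E}\subseteq L$ it holds that $(h(D)\cap\overline{h(E)})\setminus L\ne\emptyset$. $C_n$ is the $n\times n$ $0,1$-matrix with zeros on the diagonal and ones elsewhere. The Boolean rank $\mathrm{R}_{\mathbb{B}}(A)$ of a $0,1$-matrix is the smallest number of all-ones combinatorial rectangles needed to cover its $1$-entries. A collection of $0,1$-matrices covers $A$ if $A_{i,j}=1$ iff some matrix of the collection has a $1$ in entry $(i,j)$. $A$ is $(a_1,a_2,a_3)$-coverable if there exist three matrices $A_1,A_2,A_3$ with $\mathrm{R}_{\mathbb{B}}(A_i)\le a_i$ for all $i$ such that every two of them cover $A$. The Kronecker product $A\otimes B$ is the block matrix with $(i,j)$-th block $A_{i,j}B$. -}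

module Defs where

open import Data.Nat using (ℕ; _<_; _+_; _*_; _∸_; _/_)
open import Data.Bool using (Bool; true; false; _∧_; _∨_; not)
open import Data.Fin using (Fin; toℕ)
open import Data.Fin.Subset using (Subset; _∈_; _∩_; ∁; Nonempty)
open import Data.Product using (Σ; ∃; _×_; _,_)
open import Relation.Nullary using (¬_)
open import Relation.Binary.PropositionalEquality using (_≡_)

⌈_/2⌉ : ℕ → ℕ
⌈ k /2⌉ = (k + 1) / 2

-- the set [r] = {1,…,r} ⊆ [k]; element i : Fin k represents the number toℕ i + 1
initSeg : (k r : ℕ) → Fin k → Set
initSeg k r i = toℕ i < r

_⊆[_] : {k : ℕ} → Subset k → ℕ → Set
_⊆[_] {k} X r = ∀ i → i ∈ X → initSeg k r i

hasOutside : {k : ℕ} → Subset k → ℕ → Set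
hasOutside {k} X r = ∃ λ i → i ∈ X × ¬ initSeg k r i

-- family F indexed by Fin n, h given as map on indices σ (h(F a) = F (σ a))
-- L-preserving with L = [r]
Preserving : {n k : ℕ} → ℕ → (Fin n → Subset k) → (Fin n → Fin n) → Set
Preserving {n} {k} r F σ = ∀ (a : Fin n) (i : Fin k) → initSeg k r i →
  (i ∈ F a → i ∈ F (σ a)) × (i ∈ F (σ a) → i ∈ F a)

IntersectionShifting : {n k : ℕ} → ℕ → (Fin n → Subset k) → (Fin n → Fin n) → Set
IntersectionShifting r F σ = ∀ a b →
  Nonempty (F a ∩ ∁ (F b)) → (F a ∩ ∁ (F b)) ⊆[ r ] →
  hasOutside (F (σ a) ∩ ∁ (F (σ b))) r

Matrix : Set → Set → Set
Matrix I J = I → J → Bool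

RankB≤ : {I J : Set} → Matrix I J → ℕ → Set
RankB≤ {I} {J} M a =
  Σ (Fin a → I → Bool) λ R → Σ (Fin a → J → Bool) λ C →
    ∀ i j → (M i j ≡ true → ∃ λ t → R t i ≡ true × C t j ≡ true)
          × ((∃ λ t → R t i ≡ true × C t j ≡ true) → M i j ≡ true)

Covers : {I J : Set} → Matrix I J → Matrix I J → Matrix I J → Set
Covers M₁ M₂ A = ∀ i j → A i j ≡ (M₁ i j ∨ M₂ i j)

Coverable : {I J : Set} → Matrix I J → ℕ → ℕ → ℕ → Set
Coverable {I} {J} A a₁ a₂ a₃ =
  Σ (Matrix I J) λ A₁ → Σ (Matrix I J) λ A₂ → Σ (Matrix I J) λ A₃ →
    RankB≤ A₁ a₁ × RankB≤ A₂ a₂ × RankB≤ A₃ a₃ ×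
    Covers A₁ A₂ A × Covers A₁ A₃ A × Covers A₂ A₃ A

C : (n : ℕ) → Matrix (Fin n) (Fin n)
C n i j = not (isYes (i ≟ j))
  where
  open import Data.Fin using (_≟_)
  open import Relation.Nullary.Decidable using (isYes)

_⊗_ : {I J I′ J′ : Set} → Matrix I J → Matrix I′ J′ → Matrix (I × I′) (J × J′)
(A ⊗ B) (i , i′) (j , j′) = A i j ∧ B i′ j′

-- For a ≠ b the sets F a, F b are distinct of equal size, so F a ∖ F b ≠ ∅. Let A₁ (resp. A₂) mark
-- the pairs (a , b) for which F a ∖ F b meets [r] (resp. its complement), and A₃ those for which
-- h(F a) ∖ h(F b) meets the complement of [r]; each is a union of one rectangle per coordinate,
-- which gives the ranks r, k − r, k − r. A₁, A₂ cover C n by the remark above; A₁, A₃ do because h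
-- preserves [r]; and A₂, A₃ do because h is [r]-intersection shifting. Finally, at every 1-entry
-- of C n at least two of A₁, A₂, A₃ are 1, so A₁ ⊗ A₂, A₂ ⊗ A₁, A₃ ⊗ A₃ cover C n ⊗ C n, of total
-- rank 2r(k − r) + (k − r)² = k² − r².
module Submission where

open import Defs
open import Data.Bool using (Bool; true; false; _∧_; _∨_)
open import Data.Bool.Properties using (∧-conicalˡ; ∧-conicalʳ; ∨-zeroʳ; ∧-zeroʳ)
open import Data.Empty using (⊥-elim)
open import Data.Fin using (Fin; toℕ; fromℕ<; inject≤; splitAt; _↑ˡ_; _↑ʳ_; remQuot; combine; _≟_)
open import Data.Fin.Properties using (toℕ-injective; toℕ-fromℕ<; toℕ-inject≤; toℕ<n; splitAt-↑ˡ; splitAt-↑ʳ; remQuot-combine; any?)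
open import Data.Fin.Subset using (Subset; ∣_∣; _∈_; _∩_; ∁; _⊆_; Nonempty; Empty)
open import Data.Fin.Subset.Properties using (_∈?_; nonempty?; x∈p∩q⁺; x∈p∩q⁻; x∉∁p⇒x∈p; x∈∁p⇒x∉p; x∉p⇒x∈∁p; ⊆-antisym; p⊂q⇒∣p∣<∣q∣)
open import Data.Nat using (ℕ; _≤_; _<_; _+_; _*_; _∸_; _<?_)
open import Data.Nat.Properties using (≤-refl; ≤⇒≯; ≮⇒≥; +-monoʳ-<; m+[n∸m]≡n; m+n∸m≡n; ∸-monoˡ-<)
open import Data.Nat.Solver using (module +-*-Solver)
open import Data.Product using (∃; _×_; _,_; proj₁; proj₂)
open import Data.Sum using (_⊎_; inj₁; inj₂; [_,_]′)
open import Function using (_∘_; case_of_)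
open import Function.Definitions using (Injective; Bijective)
open import Relation.Nullary using (¬_; Dec; yes; no; does; _×-dec_)
open import Relation.Nullary.Decidable using (dec-true; dec-false)
open import Relation.Binary.PropositionalEquality using (_≡_; _≢_; refl; sym; trans; cong; cong₂; cong-app; subst; module ≡-Reasoning)

does-true⇒ : ∀ {a} {A : Set a} (a? : Dec A) → does a? ≡ true → A
does-true⇒ (yes a) _ = a

∧-true⇒× : ∀ x y → x ∧ y ≡ true → x ≡ true × y ≡ true
∧-true⇒× x y p = ∧-conicalˡ x y p , ∧-conicalʳ x y p

∨-true⇒⊎ : ∀ x {y} → x ∨ y ≡ true → x ≡ true ⊎ y ≡ true
∨-true⇒⊎ true  _ = inj₁ refl
∨-true⇒⊎ false p = inj₂ p

∨-true⇐ˡ : ∀ {x} y → x ≡ true → x ∨ y ≡ true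
∨-true⇐ˡ y refl = refl

∨-true⇐ʳ : ∀ x {y} → y ≡ true → x ∨ y ≡ true
∨-true⇐ʳ x refl = ∨-zeroʳ x

pairwise-∨-∧ : ∀ {x y} x₁ x₂ x₃ y₁ y₂ y₃ →
  x ≡ x₁ ∨ x₂ → x ≡ x₁ ∨ x₃ → x ≡ x₂ ∨ x₃ →
  y ≡ y₁ ∨ y₂ → y ≡ y₁ ∨ y₃ → y ≡ y₂ ∨ y₃ →
  x ∧ y ≡ (x₁ ∧ y₂ ∨ x₂ ∧ y₁) ∨ x₃ ∧ y₃
pairwise-∨-∧ true  true  _  true  true  _ refl _ _ refl _ _ = refl
pairwise-∨-∧ true  true  _  true  false _ refl _ _ refl _ _ = refl
pairwise-∨-∧ true  true  _  false true  _ refl _ _ refl _ _ = refl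
pairwise-∨-∧ true  true  x₃ false false _ refl _ _ refl refl _ = sym (∧-zeroʳ x₃)
pairwise-∨-∧ true  false _  true  true  _ refl _ refl refl _ _ = refl
pairwise-∨-∧ true  false _  true  false _ refl _ refl refl _ refl = refl
pairwise-∨-∧ true  false _  false true  _ refl _ refl refl refl _ = refl
pairwise-∨-∧ true  false _  false false _ refl _ refl refl refl _ = refl
pairwise-∨-∧ false true  _  true  true  _ refl refl _ refl _ _ = refl
pairwise-∨-∧ false true  _  true  false _ refl refl _ refl _ refl = refl
pairwise-∨-∧ false true  _  false true  _ refl refl _ refl refl _ = refl
pairwise-∨-∧ false true  _  false false _ refl refl _ refl refl _ = refl
pairwise-∨-∧ false false _  _     _     _ refl _ refl _ _ _ = refl

module _ {I J : Set} where

  RankB≤-resp : {M N : Matrix I J} {a : ℕ} → (∀ i j → M i j ≡ N i j) → RankB≤ M a → RankB≤ N a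
  RankB≤-resp M≡N (R , C′ , h) = R , C′ , λ i j →
    (λ p → proj₁ (h i j) (trans (M≡N i j) p)) , (λ q → trans (sym (M≡N i j)) (proj₂ (h i j) q))

  RankB≤-rectangles : {p : ℕ} {Row : Fin p → I → Set} {Col : Fin p → J → Set} →
    (Row? : ∀ t i → Dec (Row t i)) (Col? : ∀ t j → Dec (Col t j)) →
    RankB≤ (λ i j → does (any? λ t → Row? t i ×-dec Col? t j)) p
  RankB≤-rectangles {Row = Row} {Col} Row? Col? = (λ t → does ∘ Row? t) , (λ t → does ∘ Col? t) , λ i j →
    (λ p → let t , row , col = does-true⇒ (in-rectangle? i j) p in
      t , dec-true (Row? t i) row , dec-true (Col? t j) col) ,
    (λ (t , row , col) → dec-true (in-rectangle? i j)
      (t , does-true⇒ (Row? t i) row , does-true⇒ (Col? t j) col))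
    where
    in-rectangle? : ∀ i j → Dec (∃ λ t → Row t i × Col t j)
    in-rectangle? i j = any? λ t → Row? t i ×-dec Col? t j

  RankB≤-∨ : {M N : Matrix I J} {a b : ℕ} → RankB≤ M a → RankB≤ N b →
    RankB≤ (λ i j → M i j ∨ N i j) (a + b)
  RankB≤-∨ {M} {N} {a} {b} (R₁ , C₁ , h₁) (R₂ , C₂ , h₂) = R , C′ , λ i j → fw i j , bw i j
    where
    R : Fin (a + b) → I → Bool
    R = [ R₁ , R₂ ]′ ∘ splitAt a
    C′ : Fin (a + b) → J → Bool
    C′ = [ C₁ , C₂ ]′ ∘ splitAt a

    R-↑ˡ : ∀ t → R (t ↑ˡ b) ≡ R₁ t
    R-↑ˡ t = cong [ R₁ , R₂ ]′ (splitAt-↑ˡ a t b)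
    C-↑ˡ : ∀ t → C′ (t ↑ˡ b) ≡ C₁ t
    C-↑ˡ t = cong [ C₁ , C₂ ]′ (splitAt-↑ˡ a t b)
    R-↑ʳ : ∀ t → R (a ↑ʳ t) ≡ R₂ t
    R-↑ʳ t = cong [ R₁ , R₂ ]′ (splitAt-↑ʳ a b t)
    C-↑ʳ : ∀ t → C′ (a ↑ʳ t) ≡ C₂ t
    C-↑ʳ t = cong [ C₁ , C₂ ]′ (splitAt-↑ʳ a b t)

    fw : ∀ i j → M i j ∨ N i j ≡ true → ∃ λ t → R t i ≡ true × C′ t j ≡ true
    fw i j p with ∨-true⇒⊎ (M i j) p
    ... | inj₁ q = let t , x , y = proj₁ (h₁ i j) q in
      t ↑ˡ b , trans (cong-app (R-↑ˡ t) i) x , trans (cong-app (C-↑ˡ t) j) y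
    ... | inj₂ q = let t , x , y = proj₁ (h₂ i j) q in
      a ↑ʳ t , trans (cong-app (R-↑ʳ t) i) x , trans (cong-app (C-↑ʳ t) j) y

    bw : ∀ i j → (∃ λ t → R t i ≡ true × C′ t j ≡ true) → M i j ∨ N i j ≡ true
    bw i j (t , x , y) with splitAt a t
    ... | inj₁ t₁ = ∨-true⇐ˡ (N i j) (proj₂ (h₁ i j) (t₁ , x , y))
    ... | inj₂ t₂ = ∨-true⇐ʳ (M i j) (proj₂ (h₂ i j) (t₂ , x , y))

RankB≤-⊗ : {I J I′ J′ : Set} {M : Matrix I J} {N : Matrix I′ J′} {a b : ℕ} →
  RankB≤ M a → RankB≤ N b → RankB≤ (M ⊗ N) (a * b)
RankB≤-⊗ {M = M} {N} {a} {b} (R₁ , C₁ , h₁) (R₂ , C₂ , h₂) = R , C′ , λ (i , i′) (j , j′) → fw i i′ j j′ , bw i i′ j j′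
  where
  R : Fin (a * b) → _ → Bool
  R t (i , i′) = let t₁ , t₂ = remQuot {a} b t in R₁ t₁ i ∧ R₂ t₂ i′
  C′ : Fin (a * b) → _ → Bool
  C′ t (j , j′) = let t₁ , t₂ = remQuot {a} b t in C₁ t₁ j ∧ C₂ t₂ j′

  fw : ∀ i i′ j j′ → M i j ∧ N i′ j′ ≡ true → ∃ λ t → R t (i , i′) ≡ true × C′ t (j , j′) ≡ true
  fw i i′ j j′ p =
    let p₁ , p₂ = ∧-true⇒× (M i j) (N i′ j′) p
        t₁ , x₁ , y₁ = proj₁ (h₁ i j) p₁
        t₂ , x₂ , y₂ = proj₁ (h₂ i′ j′) p₂
    in combine t₁ t₂ ,
       subst (λ (s₁ , s₂) → R₁ s₁ i ∧ R₂ s₂ i′ ≡ true) (sym (remQuot-combine t₁ t₂)) (cong₂ _∧_ x₁ x₂) ,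
       subst (λ (s₁ , s₂) → C₁ s₁ j ∧ C₂ s₂ j′ ≡ true) (sym (remQuot-combine t₁ t₂)) (cong₂ _∧_ y₁ y₂)

  bw : ∀ i i′ j j′ → (∃ λ t → R t (i , i′) ≡ true × C′ t (j , j′) ≡ true) → M i j ∧ N i′ j′ ≡ true
  bw i i′ j j′ (t , x , y) =
    let t₁ , t₂ = remQuot {a} b t
        x₁ , x₂ = ∧-true⇒× (R₁ t₁ i) _ x
        y₁ , y₂ = ∧-true⇒× (C₁ t₁ j) _ y
    in cong₂ _∧_ (proj₂ (h₁ i j) (t₁ , x₁ , y₁)) (proj₂ (h₂ i′ j′) (t₂ , x₂ , y₂))

RankB≤-⊗-coverable : {I J I′ J′ : Set} {A : Matrix I J} {B : Matrix I′ J′} {a₁ a₂ a₃ b₁ b₂ b₃ : ℕ} →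
  Coverable A a₁ a₂ a₃ → Coverable B b₁ b₂ b₃ → RankB≤ (A ⊗ B) (a₁ * b₂ + a₂ * b₁ + a₃ * b₃)
RankB≤-⊗-coverable {A = A} {B} (A₁ , A₂ , A₃ , ρ₁ , ρ₂ , ρ₃ , A₁₂ , A₁₃ , A₂₃) (B₁ , B₂ , B₃ , ϱ₁ , ϱ₂ , ϱ₃ , B₁₂ , B₁₃ , B₂₃) =
  RankB≤-resp cover (RankB≤-∨ (RankB≤-∨ (RankB≤-⊗ ρ₁ ϱ₂) (RankB≤-⊗ ρ₂ ϱ₁)) (RankB≤-⊗ ρ₃ ϱ₃))
  where
  cover : ∀ x y → ((A₁ ⊗ B₂) x y ∨ (A₂ ⊗ B₁) x y) ∨ (A₃ ⊗ B₃) x y ≡ (A ⊗ B) x y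
  cover (i , i′) (j , j′) = sym (pairwise-∨-∧ (A₁ i j) (A₂ i j) (A₃ i j) (B₁ i′ j′) (B₂ i′ j′) (B₃ i′ j′)
    (A₁₂ i j) (A₁₃ i j) (A₂₃ i j) (B₁₂ i′ j′) (B₁₃ i′ j′) (B₂₃ i′ j′))

Covers-C : ∀ {n} {A₁ A₂ : Matrix (Fin n) (Fin n)} → (∀ a → A₁ a a ≡ false) → (∀ a → A₂ a a ≡ false) →
  (∀ a b → a ≢ b → A₁ a b ≡ true ⊎ A₂ a b ≡ true) → Covers A₁ A₂ (C n)
Covers-C {A₁ = A₁} {A₂} diag₁ diag₂ off a b with a ≟ b
... | yes refl = sym (cong₂ _∨_ (diag₁ a) (diag₂ a))
... | no a≢b = sym ([ ∨-true⇐ˡ (A₂ a b) , ∨-true⇐ʳ (A₁ a b) ]′ (off a b a≢b))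

Empty[p∩∁q]⇒p⊆q : ∀ {k} {p q : Subset k} → Empty (p ∩ ∁ q) → p ⊆ q
Empty[p∩∁q]⇒p⊆q empty x∈p = x∉∁p⇒x∈p λ x∈∁q → empty (_ , x∈p∩q⁺ (x∈p , x∈∁q))

∣q∣≤∣p∣⇒p≢q⇒Nonempty[p∩∁q] : ∀ {k} {p q : Subset k} → ∣ q ∣ ≤ ∣ p ∣ → p ≢ q → Nonempty (p ∩ ∁ q)
∣q∣≤∣p∣⇒p≢q⇒Nonempty[p∩∁q] {p = p} {q} ∣q∣≤∣p∣ p≢q with nonempty? (p ∩ ∁ q) | nonempty? (q ∩ ∁ p)
... | yes p∖q≠∅ | _ = p∖q≠∅
... | no p∖q=∅ | yes (x , x∈q∖p) =
  let x∈q , x∈∁p = x∈p∩q⁻ q (∁ p) x∈q∖p in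
  ⊥-elim (≤⇒≯ ∣q∣≤∣p∣ (p⊂q⇒∣p∣<∣q∣ (Empty[p∩∁q]⇒p⊆q p∖q=∅ , x , x∈q , x∈∁p⇒x∉p x∈∁p)))
... | no p∖q=∅ | no q∖p=∅ = ⊥-elim (p≢q (⊆-antisym (Empty[p∩∁q]⇒p⊆q p∖q=∅) (Empty[p∩∁q]⇒p⊆q q∖p=∅)))

separation : ∀ {I : Set} {k p} → (I → Subset k) → (Fin p → Fin k) → Matrix I I
separation X ι a b = does (any? λ t → (ι t ∈? X a) ×-dec (ι t ∈? ∁ (X b)))

module _ {I : Set} {k p : ℕ} (X : I → Subset k) (ι : Fin p → Fin k) where

  separation-rank : RankB≤ (separation X ι) p
  separation-rank = RankB≤-rectangles (λ t a → ι t ∈? X a) (λ t b → ι t ∈? ∁ (X b))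

  separation-diag : ∀ a → separation X ι a a ≡ false
  separation-diag a = dec-false (any? λ t → (ι t ∈? X a) ×-dec (ι t ∈? ∁ (X a)))
    λ (t , ∈X , ∈∁X) → x∈∁p⇒x∉p ∈∁X ∈X

  separation-true : ∀ {a b i} → (∃ λ t → ι t ≡ i) → i ∈ X a ∩ ∁ (X b) → separation X ι a b ≡ true
  separation-true {a} {b} (t , refl) ∈diff =
    dec-true (any? λ t → (ι t ∈? X a) ×-dec (ι t ∈? ∁ (X b))) (t , x∈p∩q⁻ (X a) (∁ (X b)) ∈diff)

module Coordinates {k r : ℕ} (r≤k : r ≤ k) where

  below : Fin r → Fin k
  below t = inject≤ t r≤k

  above : Fin (k ∸ r) → Fin k
  above t = fromℕ< (subst (r + toℕ t <_) (m+[n∸m]≡n r≤k) (+-monoʳ-< r (toℕ<n t)))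

  below-onto : ∀ {i} → initSeg k r i → ∃ λ t → below t ≡ i
  below-onto i<r = fromℕ< i<r , toℕ-injective (trans (toℕ-inject≤ _ r≤k) (toℕ-fromℕ< i<r))

  above-onto : ∀ {i} → ¬ initSeg k r i → ∃ λ t → above t ≡ i
  above-onto {i} i≮r = fromℕ< i∸r<k∸r , toℕ-injective (begin
      toℕ (above (fromℕ< i∸r<k∸r)) ≡⟨ toℕ-fromℕ< _ ⟩
      r + toℕ (fromℕ< i∸r<k∸r)     ≡⟨ cong (r +_) (toℕ-fromℕ< i∸r<k∸r) ⟩
      r + (toℕ i ∸ r)              ≡⟨ m+[n∸m]≡n (≮⇒≥ i≮r) ⟩
      toℕ i                        ∎)
    where
    open ≡-Reasoning
    i∸r<k∸r : toℕ i ∸ r < k ∸ r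
    i∸r<k∸r = ∸-monoˡ-< (toℕ<n i) (≮⇒≥ i≮r)

module ThreeMatrices {k r n : ℕ} (r≤k : r ≤ k) (F : Fin n → Subset k) (F-injective : Injective _≡_ _≡_ F)
  (F-equal-size : ∀ a b → ∣ F a ∣ ≡ ∣ F b ∣) (σ : Fin n → Fin n) (σ-injective : Injective _≡_ _≡_ σ)
  (preserving : Preserving r F σ) (shifting : IntersectionShifting r F σ) where

  open Coordinates r≤k

  A₁ A₂ A₃ : Matrix (Fin n) (Fin n)
  A₁ = separation F below
  A₂ = separation F above
  A₃ = separation (F ∘ σ) above

  F-separates : ∀ {a b} → a ≢ b → Nonempty (F a ∩ ∁ (F b))
  F-separates {a} {b} a≢b =
    ∣q∣≤∣p∣⇒p≢q⇒Nonempty[p∩∁q] (subst (_≤ ∣ F a ∣) (F-equal-size a b) ≤-refl) (a≢b ∘ F-injective)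

  preserving-∩∁ : ∀ {a b i} → initSeg k r i → i ∈ F (σ a) ∩ ∁ (F (σ b)) → i ∈ F a ∩ ∁ (F b)
  preserving-∩∁ {a} {b} {i} i<r ∈diff =
    let ∈Fσa , ∈∁Fσb = x∈p∩q⁻ (F (σ a)) (∁ (F (σ b))) ∈diff in
    x∈p∩q⁺ (proj₂ (preserving a i i<r) ∈Fσa , x∉p⇒x∈∁p (x∈∁p⇒x∉p ∈∁Fσb ∘ proj₁ (preserving b i i<r)))

  covers₁₂ : Covers A₁ A₂ (C n)
  covers₁₂ = Covers-C (separation-diag F below) (separation-diag F above) λ a b a≢b →
    let i , ∈diff = F-separates a≢b in
    case toℕ i <? r of λ where
      (yes i<r) → inj₁ (separation-true F below (below-onto i<r) ∈diff)
      (no i≮r)  → inj₂ (separation-true F above (above-onto i≮r) ∈diff)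

  covers₁₃ : Covers A₁ A₃ (C n)
  covers₁₃ = Covers-C (separation-diag F below) (separation-diag (F ∘ σ) above) λ a b a≢b →
    let i , ∈diff = F-separates (a≢b ∘ σ-injective) in
    case toℕ i <? r of λ where
      (yes i<r) → inj₁ (separation-true F below (below-onto i<r) (preserving-∩∁ i<r ∈diff))
      (no i≮r)  → inj₂ (separation-true (F ∘ σ) above (above-onto i≮r) ∈diff)

  covers₂₃ : Covers A₂ A₃ (C n)
  covers₂₃ = Covers-C (separation-diag F above) (separation-diag (F ∘ σ) above) off
    where
    off : ∀ a b → a ≢ b → A₂ a b ≡ true ⊎ A₃ a b ≡ true
    off a b a≢b with A₂ a b in A₂ab
    ... | true  = inj₁ refl
    ... | false = let j , ∈diff , j≮r = shifting a b (F-separates a≢b) diff⊆[r] in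
      inj₂ (separation-true (F ∘ σ) above (above-onto j≮r) ∈diff)
      where
      diff⊆[r] : (F a ∩ ∁ (F b)) ⊆[ r ]
      diff⊆[r] j ∈diff with toℕ j <? r
      ... | yes j<r = j<r
      ... | no j≮r with () ← trans (sym A₂ab) (separation-true F above (above-onto j≮r) ∈diff)

  coverable : Coverable (C n) r (k ∸ r) (k ∸ r)
  coverable = A₁ , A₂ , A₃ , separation-rank F below , separation-rank F above , separation-rank (F ∘ σ) above ,
              covers₁₂ , covers₁₃ , covers₂₃

open +-*-Solver using (solve; _:+_; _:*_; _:=_)

r*s+s*r+s*s≡k*k∸r*r : ∀ {r k} → r ≤ k → let s = k ∸ r in r * s + s * r + s * s ≡ k * k ∸ r * r
r*s+s*r+s*s≡k*k∸r*r {r} {k} r≤k = begin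
    r * s + s * r + s * s                   ≡⟨ sym (m+n∸m≡n (r * r) _) ⟩
    r * r + (r * s + s * r + s * s) ∸ r * r ≡⟨ cong (_∸ r * r) (sym (square r s)) ⟩
    (r + s) * (r + s) ∸ r * r               ≡⟨ cong (λ m → m * m ∸ r * r) (m+[n∸m]≡n r≤k) ⟩
    k * k ∸ r * r                           ∎
  where
  open ≡-Reasoning
  s = k ∸ r
  square : ∀ r s → (r + s) * (r + s) ≡ r * r + (r * s + s * r + s * s)
  square = solve 2 (λ r s → (r :+ s) :* (r :+ s) := r :* r :+ (r :* s :+ s :* r :+ s :* s)) refl

theorem4 : (k r n : ℕ) → 1 ≤ r → r ≤ k →
    (F : Fin n → Subset k) → Injective _≡_ _≡_ F →
    (∀ a → ∣ F a ∣ ≡ ⌈ k /2⌉) →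
    (σ : Fin n → Fin n) → Bijective _≡_ _≡_ σ →
    Preserving r F σ → IntersectionShifting r F σ →
    Coverable (C n) r (k ∸ r) (k ∸ r)
      × RankB≤ (C n ⊗ C n) (k * k ∸ r * r)
theorem4 k r n _ r≤k F F-injective size σ (σ-injective , _) preserving shifting =
  coverable , subst (RankB≤ (C n ⊗ C n)) (r*s+s*r+s*s≡k*k∸r*r r≤k) (RankB≤-⊗-coverable coverable coverable)
  where
  open ThreeMatrices r≤k F F-injective (λ a b → trans (size a) (sym (size b))) σ σ-injective preserving shifting
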